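{- Let $2=\{0,1\}$ be the two-element Boolean algebra, viewed as an object of $\mathbf{OMLatGal}$. For every orthomodular lattice $X$ there is a bijection $X\cong\mathbf{OMLatGal}(2,X)$ sending $a\in X$ to $\bar a\colon 2\to X$ with $\bar a_*(0)=1$, $\bar a_*(1)=a^\perp$, and $\bar a^*(x)=1$ if $x\le a^\perp$, $\bar a^*(x)=0$ otherwise. It is natural: for every morphism $f\colon X\to Y$ of $\mathbf{OMLatGal}$ and $a\in X$, $f\circ\bar a=\overline{f_*(a)^\perp}$.
   Context: An orthomodular lattice is a bounded lattice with orthocomplement $x\mapsto x^\perp$ ($x^{\perp\perp}=x$, order-reversing, $x\wedge x^\perp=0$) with $x\le y\Rightarrow y=x\vee(x^\perp\wedge y)$. $\mathbf{OMLatGal}$: objects orthomodular lattices; morphisms $f\colon X\to Y$ pairs $(f_*,f^*)$ of order-reversing maps $f_*\colon X\to Y$, $f^*\colon Y\to X$ with $x\le f^*(y)\iff y\le f_*(x)$; identity $((-)^\perp,(-)^\perp)$; composition $(g\circ f)_*=g_*\circ(-)^\perp\circ f_*$, $(g\circ f)^*=f^*\circ(-)^\perp\circ g^*$. -}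

module Defs where

open import Level using (Level; _⊔_; 0ℓ) renaming (suc to lsuc)
open import Data.Bool using (Bool; true; false; not) renaming (_≤_ to _≤ᵇ_; _∧_ to _∧ᵇ_; _∨_ to _∨ᵇ_)
open import Data.Bool.Properties using (≤-isPartialOrder)
open import Data.Bool using (b≤b; f≤t)
open import Data.Product using (_×_; _,_)
open import Relation.Binary.PropositionalEquality using (_≡_; refl)
open import Relation.Binary.Lattice.Structures using (IsBoundedLattice; IsLattice)

record OML (c ℓ : Level) : Set (lsuc (c ⊔ ℓ)) where
  infixr 7 _∧_
  infixr 6 _∨_
  infix 4 _≤_
  field
    Carrier : Set c
    _≤_     : Carrier → Carrier → Set ℓ
    _∨_     : Carrier → Carrier → Carrier
    _∧_     : Carrier → Carrier → Carrier
    ⊤ ⊥     : Carrier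
    isBoundedLattice : IsBoundedLattice _≡_ _≤_ _∨_ _∧_ ⊤ ⊥
    _ᶜ      : Carrier → Carrier
    ᶜ-involutive : ∀ x → (x ᶜ) ᶜ ≡ x
    ᶜ-antitone   : ∀ {x y} → x ≤ y → y ᶜ ≤ x ᶜ
    ᶜ-meet       : ∀ x → x ∧ (x ᶜ) ≡ ⊥
    orthomodular : ∀ {x y} → x ≤ y → y ≡ x ∨ ((x ᶜ) ∧ y)

open OML public using (Carrier)

record Hom {c₁ ℓ₁ c₂ ℓ₂} (X : OML c₁ ℓ₁) (Y : OML c₂ ℓ₂) : Set (c₁ ⊔ ℓ₁ ⊔ c₂ ⊔ ℓ₂) where
  private
    module X = OML X
    module Y = OML Y
  field
    lower : X.Carrier → Y.Carrier
    upper : Y.Carrier → X.Carrier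
    lower-antitone : ∀ {x x'} → x X.≤ x' → lower x' Y.≤ lower x
    upper-antitone : ∀ {y y'} → y Y.≤ y' → upper y' X.≤ upper y
    galois→ : ∀ x y → x X.≤ upper y → y Y.≤ lower x
    galois← : ∀ x y → y Y.≤ lower x → x X.≤ upper y

open Hom public

_≈ₕ_ : ∀ {c₁ ℓ₁ c₂ ℓ₂} {X : OML c₁ ℓ₁} {Y : OML c₂ ℓ₂} → Hom X Y → Hom X Y → Set (c₁ ⊔ c₂)
f ≈ₕ g = (∀ x → lower f x ≡ lower g x) × (∀ y → upper f y ≡ upper g y)

_∘ₕ_ : ∀ {c₁ ℓ₁ c₂ ℓ₂ c₃ ℓ₃} {X : OML c₁ ℓ₁} {Y : OML c₂ ℓ₂} {Z : OML c₃ ℓ₃} →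
       Hom Y Z → Hom X Y → Hom X Z
_∘ₕ_ {X = X} {Y} {Z} g f = record
  { lower = λ x → lower g (OML._ᶜ Y (lower f x))
  ; upper = λ z → upper f (OML._ᶜ Y (upper g z))
  ; lower-antitone = λ p → lower-antitone g (OML.ᶜ-antitone Y (lower-antitone f p))
  ; upper-antitone = λ p → upper-antitone f (OML.ᶜ-antitone Y (upper-antitone g p))
  ; galois→ = λ x z p →
      galois→ g (OML._ᶜ Y (lower f x)) z
        (subst-≤ (OML.ᶜ-antitone Y (galois→ f x (OML._ᶜ Y (upper g z)) p)))
  ; galois← = λ x z p →
      galois← f x (OML._ᶜ Y (upper g z))
        (subst-≤ (OML.ᶜ-antitone Y (galois← g (OML._ᶜ Y (lower f x)) z p)))
  }
  where
  open OML Y using (_≤_; _ᶜ; ᶜ-involutive)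
  subst-≤ : ∀ {a b} → (b ᶜ) ≤ ((a ᶜ) ᶜ) → (b ᶜ) ≤ a
  subst-≤ {a} p rewrite ᶜ-involutive a = p

-- The two-element Boolean algebra 2 = {0,1} (false = 0, true = 1).
Two : OML 0ℓ 0ℓ
Two = record
  { Carrier = Bool
  ; _≤_ = _≤ᵇ_
  ; _∨_ = _∨ᵇ_
  ; _∧_ = _∧ᵇ_
  ; ⊤ = true
  ; ⊥ = false
  ; isBoundedLattice = record
    { isLattice = record
      { isPartialOrder = ≤-isPartialOrder
      ; supremum = sup
      ; infimum = inf
      }
    ; maximum = max
    ; minimum = min
    }
  ; _ᶜ = not
  ; ᶜ-involutive = λ { true → refl ; false → refl }
  ; ᶜ-antitone = λ { b≤b → b≤b ; f≤t → f≤t }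
  ; ᶜ-meet = λ { true → refl ; false → refl }
  ; orthomodular = λ { {false} {false} b≤b → refl ; {true} b≤b → refl ; f≤t → refl }
  }
  where
  refl≤ : ∀ {x} → x ≤ᵇ x
  refl≤ = b≤b
  sup : ∀ x y → x ≤ᵇ (x ∨ᵇ y) × y ≤ᵇ (x ∨ᵇ y) × (∀ z → x ≤ᵇ z → y ≤ᵇ z → (x ∨ᵇ y) ≤ᵇ z)
  sup false false = f≤t' , f≤t' , λ z _ _ → ff z
    where f≤t' = b≤b
          ff : ∀ z → false ≤ᵇ z
          ff false = b≤b
          ff true = f≤t
  sup false true = f≤t , b≤b , λ z _ p → p
  sup true y = b≤b , top y , λ z p _ → p
    where top : ∀ y → y ≤ᵇ true
          top false = f≤t
          top true = b≤b
  inf : ∀ x y → (x ∧ᵇ y) ≤ᵇ x × (x ∧ᵇ y) ≤ᵇ y × (∀ z → z ≤ᵇ x → z ≤ᵇ y → z ≤ᵇ (x ∧ᵇ y))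
  inf true true = b≤b , b≤b , λ z p _ → p
  inf true false = f≤t , b≤b , λ z _ p → p
  inf false y = b≤b , bot y , λ z p _ → p
    where bot : ∀ y → false ≤ᵇ y
          bot false = b≤b
          bot true = f≤t
  max : ∀ x → x ≤ᵇ true
  max false = f≤t
  max true = b≤b
  min : ∀ x → false ≤ᵇ x
  min false = b≤b
  min true = f≤t

open import Relation.Nullary using (¬_)

IsBar : ∀ {c ℓ} (X : OML c ℓ) → Carrier X → Hom Two X → Set (c ⊔ ℓ)
IsBar X a h =
    (lower h false ≡ OML.⊤ X)
  × (lower h true ≡ OML._ᶜ X a)
  × (∀ x → OML._≤_ X x (OML._ᶜ X a) → upper h x ≡ true)
  × (∀ x → ¬ (OML._≤_ X x (OML._ᶜ X a)) → upper h x ≡ false)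

module Submission where

-- The key observation is that a Galois connection h : 2 → X is determined
-- by the single element h_*(1): the adjunction forces h_*(0) = ⊤ and makes
-- h^* the characteristic function of the principal downset ↓h_*(1).
-- With excluded middle every downset is decidable and ā := classify (a^⊥).
-- Injectivity of a ↦ ā is injectivity of (-)^⊥, surjectivity takes
-- a := h_*(1)^⊥, and naturality compares (f ∘ ā)_*(1) = f_*(a^⊥⊥) with
-- f_*(a)^⊥⊥; in each case extensionality finishes the argument.

open import Defs
open import Level using (Level)
open import Axiom.ExcludedMiddle using (ExcludedMiddle)
open import Data.Bool using (Bool; true; false; b≤b; f≤t) renaming (_≤_ to _≤ᵇ_)
open import Data.Bool.Properties using (≤-minimum) renaming (≤-antisym to ≤ᵇ-antisym)
open import Data.Product using (Σ; _×_; ∃; _,_; proj₁)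
open import Relation.Binary.PropositionalEquality using (_≡_; refl; sym; trans; cong; subst)
open import Relation.Binary.Lattice.Structures using (IsBoundedLattice)
open import Relation.Nullary using (Dec; yes; no; does)
open import Relation.Nullary.Decidable using (dec-true; dec-false)

true≤⇒≡true : ∀ {b} → true ≤ᵇ b → b ≡ true
true≤⇒≡true b≤b = refl

implication⇒≤ᵇ : ∀ {b b′} → (b ≡ true → b′ ≡ true) → b ≤ᵇ b′
implication⇒≤ᵇ {false} {b′} _ = ≤-minimum b′
implication⇒≤ᵇ {true} imp with imp refl
... | refl = b≤b

≡true-ext : ∀ {b b′} → (b ≡ true → b′ ≡ true) → (b′ ≡ true → b ≡ true) → b ≡ b′
≡true-ext p q = ≤ᵇ-antisym (implication⇒≤ᵇ p) (implication⇒≤ᵇ q)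

does-true⇒ : ∀ {p} {P : Set p} (P? : Dec P) → does P? ≡ true → P
does-true⇒ (yes x) _ = x
does-true⇒ (no _) ()

module _ {c ℓ} (X : OML c ℓ) where
  open OML X hiding (Carrier)
  open IsBoundedLattice isBoundedLattice
    using (maximum; antisym) renaming (refl to ≤-refl; trans to ≤-trans)

  ᶜ-injective : ∀ {a b} → a ᶜ ≡ b ᶜ → a ≡ b
  ᶜ-injective {a} {b} eq =
    trans (sym (ᶜ-involutive a)) (trans (cong _ᶜ eq) (ᶜ-involutive b))

  classify : (p : Carrier X) → (∀ y → Dec (y ≤ p)) → Hom Two X
  classify p _≤p? = record
    { lower = lo
    ; upper = up
    ; lower-antitone = lo-antitone
    ; upper-antitone = up-antitone
    ; galois→ = gal→
    ; galois← = gal←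
    }
    where
    lo : Bool → Carrier X
    lo false = ⊤
    lo true  = p

    up : Carrier X → Bool
    up y = does (y ≤p?)

    up-antitone : ∀ {y y′} → y ≤ y′ → up y′ ≤ᵇ up y
    up-antitone {y} {y′} y≤y′ = implication⇒≤ᵇ λ up-y′ →
      dec-true (y ≤p?) (≤-trans y≤y′ (does-true⇒ (y′ ≤p?) up-y′))

    lo-antitone : ∀ {x x′} → x ≤ᵇ x′ → lo x′ ≤ lo x
    lo-antitone {false} b≤b = ≤-refl
    lo-antitone {true}  b≤b = ≤-refl
    lo-antitone f≤t         = maximum p

    gal→ : ∀ x y → x ≤ᵇ up y → y ≤ lo x
    gal→ false y _ = maximum y
    gal→ true  y q = does-true⇒ (y ≤p?) (true≤⇒≡true q)

    gal← : ∀ x y → y ≤ lo x → x ≤ᵇ up y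
    gal← false y _ = ≤-minimum (up y)
    gal← true  y q = implication⇒≤ᵇ λ _ → dec-true (y ≤p?) q

  module _ (h : Hom Two X) where
    lower-false : lower h false ≡ ⊤
    lower-false = antisym (maximum _) (galois→ h false ⊤ (≤-minimum _))

    upper-true⇒ : ∀ y → upper h y ≡ true → y ≤ lower h true
    upper-true⇒ y eq = galois→ h true y (implication⇒≤ᵇ λ _ → eq)

    upper-true⇐ : ∀ y → y ≤ lower h true → upper h y ≡ true
    upper-true⇐ y q = true≤⇒≡true (galois← h true y q)

  Two-hom-ext : (h g : Hom Two X) → lower h true ≡ lower g true → h ≈ₕ g
  Two-hom-ext h g eq = lower-eq , upper-eq
    where
    lower-eq : ∀ x → lower h x ≡ lower g x
    lower-eq false = trans (lower-false h) (sym (lower-false g))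
    lower-eq true  = eq

    upper-eq : ∀ y → upper h y ≡ upper g y
    upper-eq y = ≡true-ext
      (λ e → upper-true⇐ g y (subst (y ≤_) eq (upper-true⇒ h y e)))
      (λ e → upper-true⇐ h y (subst (y ≤_) (sym eq) (upper-true⇒ g y e)))

bar : ∀ {c ℓ} → ExcludedMiddle ℓ → (X : OML c ℓ) → Carrier X → Hom Two X
bar em X a = classify X (OML._ᶜ X a) (λ _ → em)

lemma3p10 : (c ℓ : Level) → ExcludedMiddle ℓ →
    Σ ((X : OML c ℓ) → Carrier X → Hom Two X) λ bar →
        (∀ (X : OML c ℓ) (a : Carrier X) → IsBar X a (bar X a))
      × (∀ (X : OML c ℓ) (a b : Carrier X) → bar X a ≈ₕ bar X b → a ≡ b)
      × (∀ (X : OML c ℓ) (h : Hom Two X) → ∃ λ (a : Carrier X) → bar X a ≈ₕ h)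
      × (∀ (X Y : OML c ℓ) (f : Hom X Y) (a : Carrier X) →
           (f ∘ₕ bar X a) ≈ₕ bar Y (OML._ᶜ Y (lower f a)))
lemma3p10 c ℓ em = bar em , isBar , injective , surjective , natural
  where
  isBar : ∀ (X : OML c ℓ) a → IsBar X a (bar em X a)
  isBar X a = refl , refl , (λ _ → dec-true em) , (λ _ → dec-false em)

  injective : ∀ (X : OML c ℓ) a b → bar em X a ≈ₕ bar em X b → a ≡ b
  injective X a b eq = ᶜ-injective X (proj₁ eq true)

  surjective : ∀ (X : OML c ℓ) h → ∃ λ a → bar em X a ≈ₕ h
  surjective X h = OML._ᶜ X (lower h true) ,
    Two-hom-ext X (bar em X _) h (OML.ᶜ-involutive X _)

  -- (f ∘ ā)_*(1) = f_*(a^⊥⊥) = f_*(a) = f_*(a)^⊥⊥ = (f_*(a)^⊥)‾_*(1).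
  natural : ∀ (X Y : OML c ℓ) f a →
    (f ∘ₕ bar em X a) ≈ₕ bar em Y (OML._ᶜ Y (lower f a))
  natural X Y f a = Two-hom-ext Y (f ∘ₕ bar em X a) (bar em Y _)
    (trans (cong (lower f) (OML.ᶜ-involutive X a)) (sym (OML.ᶜ-involutive Y _)))
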